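{- Let $L=\{a+bi+cj+dk: a,b,c,d\in\mathbb{Z}\}$ be the ring of integer (Lipschitz) quaternions, let $A\subseteq L$ and let $a,b\in L\setminus\{0\}$. If $A$ is a $\mathrm{central}^*$ set in $(L,+)$, then (a) $a^{ -1}A$, (b) $Ab^{ -1}$, and (c) $a^{ -1}Ab^{ -1}$ are $\mathrm{central}^*$ sets in $(L,+)$.
   Context: In $L$, $i^2=j^2=k^2=ijk=-1$. $a^{ -1}A=\{x\in L: ax\in A\}$, $Ab^{ -1}=\{x\in L: xb\in A\}$, $a^{ -1}Ab^{ -1}=\{x\in L: axb\in A\}$. $\beta L$ is the set of ultrafilters on $L$ with $A\in p+q$ iff $\{x:-x+A\in q\}\in p$ ($-x+A=\{y:x+y\in A\}$), a compact right topological semigroup with smallest two-sided ideal $K(\beta L)$. A set is $\mathrm{central}^*$ in $(L,+)$ if it belongs to every idempotent of $K(\beta L)$. -}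

module Defs where

open import Level using (Level; 0ℓ) renaming (suc to lsuc)
open import Data.Integer using (ℤ; _+_; _*_; _-_; 0ℤ)
open import Data.Product using (Σ; ∃; _×_; _,_)
open import Data.Sum using (_⊎_)
open import Data.Unit using (⊤)
open import Data.Empty using (⊥)
open import Relation.Nullary using (¬_)
open import Relation.Binary.PropositionalEquality using (_≡_)

record Lip : Set where
  constructor quat
  field
    re  : ℤ
    iC  : ℤ
    jC  : ℤ
    kC  : ℤ
open Lip public

0L : Lip
0L = quat 0ℤ 0ℤ 0ℤ 0ℤ

infixl 6 _+L_
infixl 7 _·L_

_+L_ : Lip → Lip → Lip
quat a b c d +L quat a' b' c' d' = quat (a + a') (b + b') (c + c') (d + d')

-- Hamilton product, with i² = j² = k² = ijk = -1
_·L_ : Lip → Lip → Lip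
quat a₁ b₁ c₁ d₁ ·L quat a₂ b₂ c₂ d₂ = quat
  (a₁ * a₂ - b₁ * b₂ - c₁ * c₂ - d₁ * d₂)
  (a₁ * b₂ + b₁ * a₂ + c₁ * d₂ - d₁ * c₂)
  (a₁ * c₂ - b₁ * d₂ + c₁ * a₂ + d₁ * b₂)
  (a₁ * d₂ + b₁ * c₂ - c₁ * b₂ + d₁ * a₂)

Subset : Set₁
Subset = Lip → Set

_⁻¹·_ : Lip → Subset → Subset
(a ⁻¹· A) x = A (a ·L x)

_·⁻¹_ : Subset → Lip → Subset
(A ·⁻¹ b) x = A (x ·L b)

conj⁻¹ : Lip → Subset → Lip → Subset
conj⁻¹ a A b x = A ((a ·L x) ·L b)

shift : Lip → Subset → Subset
shift x A y = A (x +L y)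

record Ultrafilter : Set₁ where
  field
    _∋_     : Subset → Set
    upward  : ∀ {A B : Subset} → _∋_ A → (∀ x → A x → B x) → _∋_ B
    whole   : _∋_ (λ _ → ⊤)
    noEmpty : ¬ (_∋_ (λ _ → ⊥))
    inter   : ∀ {A B : Subset} → _∋_ A → _∋_ B → _∋_ (λ x → A x × B x)
    ultra   : ∀ (A : Subset) → _∋_ A ⊎ _∋_ (λ x → ¬ A x)
open Ultrafilter public

βL : Set₁
βL = Ultrafilter

_∈_⊕_ : Subset → βL → βL → Set
A ∈ p ⊕ q = p ∋ (λ x → q ∋ shift x A)

-- r = p + q  (ultrafilters are equal iff they contain the same sets)
_≈_⊕_ : βL → βL → βL → Set₁
r ≈ p ⊕ q = ∀ (A : Subset) → (r ∋ A → A ∈ p ⊕ q) × (A ∈ p ⊕ q → r ∋ A)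

_≈_ : βL → βL → Set₁
p ≈ q = ∀ (A : Subset) → (p ∋ A → q ∋ A) × (q ∋ A → p ∋ A)

Idempotent : βL → Set₁
Idempotent p = p ≈ p ⊕ p

record IsIdeal (I : βL → Set₁) : Set₂ where
  field
    nonempty : Σ βL I
    leftAbs  : ∀ (q p : βL) → I p → Σ βL (λ r → I r × (r ≈ q ⊕ p))
    rightAbs : ∀ (p q : βL) → I p → Σ βL (λ r → I r × (r ≈ p ⊕ q))

-- Membership in the smallest two-sided ideal K(βL):
-- K(βL) is the intersection of all two-sided ideals of βL.
InK : βL → Set₂
InK p = ∀ (I : βL → Set₁) → IsIdeal I → Σ βL (λ r → I r × (r ≈ p))

CentralStar : Subset → Set₂
CentralStar A = ∀ (p : βL) → InK p → Idempotent p → p ∋ A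

{-# OPTIONS --safe #-}
-- Right or left multiplication by a nonzero Lipschitz quaternion a is an additive
-- injection f of L whose image contains N(a)·L, because a(āw) = N(a)w with
-- N(a) = aā ≠ 0.  Every idempotent p of βL contains N·L for N ≠ 0: colour each
-- coordinate by its residue mod N; p contains a colour class C, and since
-- C ∈ p + p, p-almost every x has some y with y, x + y ∈ C, so N divides that
-- coordinate of x.  Consequently the image ultrafilter f(p) is again an
-- idempotent of K(βL): for every ideal I, the ultrafilters s with f(s) ∈ I form
-- an ideal (nonempty because a member of I equivalent to p contains N·L ⊆ f[L] and
-- so lifts along f), which therefore contains p.  So a central* set A lies in
-- f(p), i.e. f⁻¹A lies in p; and a⁻¹Ab⁻¹ is a⁻¹(Ab⁻¹).
module Submission where

open import Defs
open import Data.Empty using (⊥-elim)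
open import Data.Fin using (Fin; zero; suc; fromℕ<)
open import Data.Fin.Properties using (fromℕ<-injective)
open import Data.Integer using (ℤ; +_; -[1+_]; _+_; _*_; _-_; -_; ∣_∣; 0ℤ; NonZero; ≢-nonZero; _%_; _/_)
open import Data.Integer.DivMod using (n%d<d; a≡a%n+[a/n]*n)
open import Data.Integer.Divisibility.Signed using (_∣_; divides)
open import Data.Integer.Properties using (+◃n≡+n; ∣i∣≡0⇒i≡0; *-cancelˡ-≡; *-comm)
open import Data.Integer.Tactic.RingSolver using (solve; solve-∀)
open import Data.List using (List; _∷_; [])
import Data.Nat as ℕ
import Data.Nat.Properties as ℕ
open import Data.Product using (Σ; _×_; _,_; proj₁; proj₂)
open import Data.Sum using (_⊎_; inj₁; inj₂; reduce)
open import Data.Unit using (⊤; tt)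
open import Level using (0ℓ) renaming (suc to lsuc)
open import Relation.Binary.Bundles using (Setoid)
open import Relation.Binary.PropositionalEquality using (_≡_; refl; sym; trans; cong; cong₂; subst; module ≡-Reasoning)
import Relation.Binary.Reasoning.Setoid
open import Relation.Binary.Structures using (IsEquivalence)
open import Relation.Nullary using (¬_)

quat-cong : ∀ {a b c d a′ b′ c′ d′} → a ≡ a′ → b ≡ b′ → c ≡ c′ → d ≡ d′ →
            quat a b c d ≡ quat a′ b′ c′ d′
quat-cong refl refl refl refl = refl

conj : Lip → Lip
conj (quat a b c d) = quat a (- b) (- c) (- d)

norm : Lip → ℤ
norm (quat a b c d) = a * a + b * b + c * c + d * d

infixr 7 _•_

_•_ : ℤ → Lip → Lip
n • quat a b c d = quat (n * a) (n * b) (n * c) (n * d)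

-- Each chain below starts from the product with its inner argument written out as
-- an explicit quaternion: the ring solver reads coordinates that are polynomials,
-- but treats a projection of an unevaluated product as an opaque atom.
·L-distribˡ-+L : ∀ a x y → a ·L (x +L y) ≡ a ·L x +L a ·L y
·L-distribˡ-+L (quat a b c d) (quat x₀ x₁ x₂ x₃) (quat y₀ y₁ y₂ y₃) = begin
  quat a b c d ·L quat (x₀ + y₀) (x₁ + y₁) (x₂ + y₂) (x₃ + y₃)
    ≡⟨ quat-cong (solve vs) (solve vs) (solve vs) (solve vs) ⟩
  quat (a * x₀ - b * x₁ - c * x₂ - d * x₃ + (a * y₀ - b * y₁ - c * y₂ - d * y₃))
       (a * x₁ + b * x₀ + c * x₃ - d * x₂ + (a * y₁ + b * y₀ + c * y₃ - d * y₂))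
       (a * x₂ - b * x₃ + c * x₀ + d * x₁ + (a * y₂ - b * y₃ + c * y₀ + d * y₁))
       (a * x₃ + b * x₂ - c * x₁ + d * x₀ + (a * y₃ + b * y₂ - c * y₁ + d * y₀)) ∎
  where
  open ≡-Reasoning
  vs : List ℤ
  vs = a ∷ b ∷ c ∷ d ∷ x₀ ∷ x₁ ∷ x₂ ∷ x₃ ∷ y₀ ∷ y₁ ∷ y₂ ∷ y₃ ∷ []

·L-distribʳ-+L : ∀ a x y → (x +L y) ·L a ≡ x ·L a +L y ·L a
·L-distribʳ-+L (quat a b c d) (quat x₀ x₁ x₂ x₃) (quat y₀ y₁ y₂ y₃) = begin
  quat (x₀ + y₀) (x₁ + y₁) (x₂ + y₂) (x₃ + y₃) ·L quat a b c d
    ≡⟨ quat-cong (solve vs) (solve vs) (solve vs) (solve vs) ⟩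
  quat (x₀ * a - x₁ * b - x₂ * c - x₃ * d + (y₀ * a - y₁ * b - y₂ * c - y₃ * d))
       (x₀ * b + x₁ * a + x₂ * d - x₃ * c + (y₀ * b + y₁ * a + y₂ * d - y₃ * c))
       (x₀ * c - x₁ * d + x₂ * a + x₃ * b + (y₀ * c - y₁ * d + y₂ * a + y₃ * b))
       (x₀ * d + x₁ * c - x₂ * b + x₃ * a + (y₀ * d + y₁ * c - y₂ * b + y₃ * a)) ∎
  where
  open ≡-Reasoning
  vs : List ℤ
  vs = a ∷ b ∷ c ∷ d ∷ x₀ ∷ x₁ ∷ x₂ ∷ x₃ ∷ y₀ ∷ y₁ ∷ y₂ ∷ y₃ ∷ []

·L-conj-sectionˡ : ∀ a x → a ·L (conj a ·L x) ≡ norm a • x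
·L-conj-sectionˡ (quat a b c d) (quat x y z w) = begin
  quat a b c d ·L quat (a * x - - b * y - - c * z - - d * w) (a * y + - b * x + - c * w - - d * z)
                       (a * z - - b * w + - c * x + - d * y) (a * w + - b * z - - c * y + - d * x)
    ≡⟨ quat-cong (solve vs) (solve vs) (solve vs) (solve vs) ⟩
  (a * a + b * b + c * c + d * d) • quat x y z w ∎
  where
  open ≡-Reasoning
  vs : List ℤ
  vs = a ∷ b ∷ c ∷ d ∷ x ∷ y ∷ z ∷ w ∷ []

·L-conj-retractionˡ : ∀ a x → conj a ·L (a ·L x) ≡ norm a • x
·L-conj-retractionˡ (quat a b c d) (quat x y z w) = begin
  quat a (- b) (- c) (- d) ·L quat (a * x - b * y - c * z - d * w) (a * y + b * x + c * w - d * z)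
                                   (a * z - b * w + c * x + d * y) (a * w + b * z - c * y + d * x)
    ≡⟨ quat-cong (solve vs) (solve vs) (solve vs) (solve vs) ⟩
  (a * a + b * b + c * c + d * d) • quat x y z w ∎
  where
  open ≡-Reasoning
  vs : List ℤ
  vs = a ∷ b ∷ c ∷ d ∷ x ∷ y ∷ z ∷ w ∷ []

·L-conj-sectionʳ : ∀ a x → (x ·L conj a) ·L a ≡ norm a • x
·L-conj-sectionʳ (quat a b c d) (quat x y z w) = begin
  quat (x * a - y * - b - z * - c - w * - d) (x * - b + y * a + z * - d - w * - c)
       (x * - c - y * - d + z * a + w * - b) (x * - d + y * - c - z * - b + w * a) ·L quat a b c d
    ≡⟨ quat-cong (solve vs) (solve vs) (solve vs) (solve vs) ⟩
  (a * a + b * b + c * c + d * d) • quat x y z w ∎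
  where
  open ≡-Reasoning
  vs : List ℤ
  vs = a ∷ b ∷ c ∷ d ∷ x ∷ y ∷ z ∷ w ∷ []

·L-conj-retractionʳ : ∀ a x → (x ·L a) ·L conj a ≡ norm a • x
·L-conj-retractionʳ (quat a b c d) (quat x y z w) = begin
  quat (x * a - y * b - z * c - w * d) (x * b + y * a + z * d - w * c)
       (x * c - y * d + z * a + w * b) (x * d + y * c - z * b + w * a) ·L quat a (- b) (- c) (- d)
    ≡⟨ quat-cong (solve vs) (solve vs) (solve vs) (solve vs) ⟩
  (a * a + b * b + c * c + d * d) • quat x y z w ∎
  where
  open ≡-Reasoning
  vs : List ℤ
  vs = a ∷ b ∷ c ∷ d ∷ x ∷ y ∷ z ∷ w ∷ []

square≡+∣∣² : ∀ i → i * i ≡ + (∣ i ∣ ℕ.* ∣ i ∣)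
square≡+∣∣² (+ n)    = +◃n≡+n (n ℕ.* n)
square≡+∣∣² -[1+ n ] = +◃n≡+n (ℕ.suc n ℕ.* ℕ.suc n)

∣∣²≡0⇒≡0 : ∀ i → ∣ i ∣ ℕ.* ∣ i ∣ ≡ 0 → i ≡ 0ℤ
∣∣²≡0⇒≡0 i sq≡0 = ∣i∣≡0⇒i≡0 (reduce (ℕ.m*n≡0⇒m≡0∨n≡0 ∣ i ∣ sq≡0))

m+n≡0⇒m≡0×n≡0 : ∀ m {n} → m ℕ.+ n ≡ 0 → m ≡ 0 × n ≡ 0
m+n≡0⇒m≡0×n≡0 m m+n≡0 = ℕ.m+n≡0⇒m≡0 m m+n≡0 , ℕ.m+n≡0⇒n≡0 m m+n≡0

norm≡0⇒≡0L : ∀ a → norm a ≡ 0ℤ → a ≡ 0L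
norm≡0⇒≡0L (quat a₀ a₁ a₂ a₃) N≡0
  rewrite square≡+∣∣² a₀ | square≡+∣∣² a₁ | square≡+∣∣² a₂ | square≡+∣∣² a₃
  with m+n≡0⇒m≡0×n≡0 _ (cong ∣_∣ N≡0)
... | S₀₁₂≡0 , S₃≡0 with m+n≡0⇒m≡0×n≡0 _ S₀₁₂≡0
... | S₀₁≡0 , S₂≡0 with m+n≡0⇒m≡0×n≡0 _ S₀₁≡0
... | S₀≡0 , S₁≡0 =
  quat-cong (∣∣²≡0⇒≡0 a₀ S₀≡0) (∣∣²≡0⇒≡0 a₁ S₁≡0) (∣∣²≡0⇒≡0 a₂ S₂≡0) (∣∣²≡0⇒≡0 a₃ S₃≡0)

•-injective : ∀ n .{{_ : NonZero n}} {x y} → n • x ≡ n • y → x ≡ y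
•-injective n {quat x₀ x₁ x₂ x₃} {quat y₀ y₁ y₂ y₃} eq = quat-cong
  (*-cancelˡ-≡ n x₀ y₀ (cong re eq)) (*-cancelˡ-≡ n x₁ y₁ (cong iC eq))
  (*-cancelˡ-≡ n x₂ y₂ (cong jC eq)) (*-cancelˡ-≡ n x₃ y₃ (cong kC eq))

scaled-retraction⇒injective : ∀ (f g : Lip → Lip) n .{{_ : NonZero n}} → (∀ x → g (f x) ≡ n • x) →
                              ∀ {x y} → f x ≡ f y → x ≡ y
scaled-retraction⇒injective f g n gf≡n• {x} {y} fx≡fy = •-injective n (begin
  n • x    ≡⟨ gf≡n• x ⟨
  g (f x)  ≡⟨ cong g fx≡fy ⟩
  g (f y)  ≡⟨ gf≡n• y ⟩
  n • y    ∎)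
  where open ≡-Reasoning

norm-nonZero : ∀ {a} → ¬ a ≡ 0L → NonZero (norm a)
norm-nonZero {a} a≢0 = ≢-nonZero (λ N≡0 → a≢0 (norm≡0⇒≡0L a N≡0))

∋-inhabited : ∀ (p : βL) {B : Subset} → p ∋ B → ¬ (∀ x → ¬ B x)
∋-inhabited p p∋B empty = noEmpty p (upward p p∋B empty)

∋-finite-cover : ∀ (p : βL) {m} (C : Fin m → Subset) →
                 p ∋ (λ x → Σ (Fin m) λ k → C k x) → Σ (Fin m) λ k → p ∋ C k
∋-finite-cover p {ℕ.zero} C p∋⋃ = ⊥-elim (∋-inhabited p p∋⋃ λ { x (() , _) })
∋-finite-cover p {ℕ.suc m} C p∋⋃ with ultra p (C zero)
... | inj₁ p∋C₀ = zero , p∋C₀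
... | inj₂ p∋∁C₀ =
  let k , p∋Cₖ₊₁ = ∋-finite-cover p (λ k → C (suc k)) (upward p (inter p p∋⋃ p∋∁C₀) drop-zero)
  in suc k , p∋Cₖ₊₁
  where
  drop-zero : ∀ x → Σ (Fin (ℕ.suc m)) (λ k → C k x) × ¬ C zero x → Σ (Fin m) λ k → C (suc k) x
  drop-zero x ((zero  , C₀x) , ¬C₀x) = ⊥-elim (¬C₀x C₀x)
  drop-zero x ((suc k , Cx)  , _)    = k , Cx

∋-colour-class : ∀ (p : βL) {m} (c : Lip → Fin m) → Σ (Fin m) λ k → p ∋ (λ x → c x ≡ k)
∋-colour-class p c = ∋-finite-cover p (λ k x → c x ≡ k) (upward p (whole p) λ x _ → c x , refl)

infixl 6 _+β_

_+β_ : βL → βL → βL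
p +β q = record
  { _∋_     = _∈ p ⊕ q
  ; upward  = λ p∋ A⊆B → upward p p∋ λ x q∋ → upward q q∋ λ y → A⊆B (x +L y)
  ; whole   = upward p (whole p) λ _ _ → whole q
  ; noEmpty = λ p∋ → noEmpty p (upward p p∋ λ _ → noEmpty q)
  ; inter   = λ p∋A p∋B → upward p (inter p p∋A p∋B) λ { _ (q∋A , q∋B) → inter q q∋A q∋B }
  ; ultra   = ultra′
  }
  where
  ultra′ : ∀ A → A ∈ p ⊕ q ⊎ (λ x → ¬ A x) ∈ p ⊕ q
  ultra′ A with ultra p (λ x → q ∋ shift x A)
  ... | inj₁ p∋ = inj₁ p∋
  ... | inj₂ p∋ = inj₂ (upward p p∋ q∌⇒q∋∁)
    where
    q∌⇒q∋∁ : ∀ x → ¬ q ∋ shift x A → q ∋ shift x (λ y → ¬ A y)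
    q∌⇒q∋∁ x q∌ with ultra q (shift x A)
    ... | inj₁ q∋ = ⊥-elim (q∌ q∋)
    ... | inj₂ q∋ = q∋

≈-isEquivalence : IsEquivalence _≈_
≈-isEquivalence = record
  { refl  = λ A → (λ p∋ → p∋) , (λ p∋ → p∋)
  ; sym   = λ p≈q A → proj₂ (p≈q A) , proj₁ (p≈q A)
  ; trans = λ p≈q q≈r A → (λ p∋ → proj₁ (q≈r A) (proj₁ (p≈q A) p∋))
                        , (λ r∋ → proj₂ (p≈q A) (proj₂ (q≈r A) r∋))
  }

βL-setoid : Setoid (lsuc 0ℓ) (lsuc 0ℓ)
βL-setoid = record { isEquivalence = ≈-isEquivalence }

module ≈-Reasoning = Relation.Binary.Reasoning.Setoid βL-setoid
open Setoid βL-setoid using () renaming (refl to ≈-refl; sym to ≈-sym)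

+β-congˡ : ∀ {p p′} q → p ≈ p′ → (p +β q) ≈ (p′ +β q)
+β-congˡ q p≈p′ A = p≈p′ (λ x → q ∋ shift x A)

+β-congʳ : ∀ p {q q′} → q ≈ q′ → (p +β q) ≈ (p +β q′)
+β-congʳ p q≈q′ A = (λ p∋ → upward p p∋ λ x → proj₁ (q≈q′ (shift x A)))
                  , (λ p∋ → upward p p∋ λ x → proj₂ (q≈q′ (shift x A)))

map : (Lip → Lip) → βL → βL
map f p = record
  { _∋_     = λ B → p ∋ (λ x → B (f x))
  ; upward  = λ p∋ A⊆B → upward p p∋ λ x → A⊆B (f x)
  ; whole   = whole p
  ; noEmpty = noEmpty p
  ; inter   = inter p
  ; ultra   = λ B → ultra p (λ x → B (f x))
  }

map-cong : ∀ f {p q} → p ≈ q → map f p ≈ map f q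
map-cong f p≈q B = p≈q (λ x → B (f x))

module _ {f : Lip → Lip} (f-additive : ∀ x y → f (x +L y) ≡ f x +L f y) where

  map-+β : ∀ p q → map f (p +β q) ≈ (map f p +β map f q)
  map-+β p q B = (λ p∋ → upward p p∋ split) , (λ p∋ → upward p p∋ merge)
    where
    split : ∀ x → q ∋ (λ y → B (f (x +L y))) → q ∋ (λ y → B (f x +L f y))
    split x q∋ = upward q q∋ λ y → subst B (f-additive x y)
    merge : ∀ x → q ∋ (λ y → B (f x +L f y)) → q ∋ (λ y → B (f (x +L y)))
    merge x q∋ = upward q q∋ λ y → subst B (sym (f-additive x y))

  map-idempotent : ∀ {p} → Idempotent p → Idempotent (map f p)
  map-idempotent {p} idem = begin
    map f p             ≈⟨ map-cong f {p} {p +β p} idem ⟩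
    map f (p +β p)      ≈⟨ map-+β p p ⟩
    map f p +β map f p  ∎
    where open ≈-Reasoning

Image : (Lip → Lip) → Subset → Subset
Image f B z = Σ Lip λ x → B x × f x ≡ z

module _ {f : Lip → Lip} (f-injective : ∀ {x y} → f x ≡ f y → x ≡ y) where

  lift : (r : βL) → r ∋ Image f (λ _ → ⊤) → βL
  lift r r∋Im = record
    { _∋_     = λ B → r ∋ Image f B
    ; upward  = λ r∋ A⊆B → upward r r∋ λ { _ (x , Ax , fx≡z) → x , A⊆B x Ax , fx≡z }
    ; whole   = r∋Im
    ; noEmpty = λ r∋ → noEmpty r (upward r r∋ λ { _ (_ , () , _) })
    ; inter   = λ r∋A r∋B → upward r (inter r r∋A r∋B) image-∩
    ; ultra   = ultra′
    }
    where
    image-∩ : ∀ {A B : Subset} z → Image f A z × Image f B z → Image f (λ x → A x × B x) z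
    image-∩ z ((x , Ax , fx≡z) , (y , By , fy≡z)) with f-injective (trans fx≡z (sym fy≡z))
    ... | refl = x , (Ax , By) , fx≡z
    ultra′ : ∀ B → r ∋ Image f B ⊎ r ∋ Image f (λ x → ¬ B x)
    ultra′ B with ultra r (Image f B)
    ... | inj₁ r∋ = inj₁ r∋
    ... | inj₂ r∋ = inj₂ (upward r (inter r r∋ r∋Im)
                     λ { _ (∉fB , (x , _ , fx≡z)) → x , (λ Bx → ∉fB (x , Bx , fx≡z)) , fx≡z })

  map-lift : ∀ r r∋Im → map f (lift r r∋Im) ≈ r
  map-lift r r∋Im B = (λ r∋ → upward r r∋ λ { _ (x , Bfx , fx≡z) → subst B fx≡z Bfx })
                    , (λ r∋ → upward r (inter r r∋ r∋Im)
                         λ { _ (Bz , (x , _ , fx≡z)) → x , subst B (sym fx≡z) Bz , fx≡z })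

idempotent-∋-difference-set : ∀ {p} → Idempotent p → ∀ {m} (c : Lip → Fin m) (Q : Subset) →
                              (∀ x y → c y ≡ c (x +L y) → Q x) → p ∋ Q
idempotent-∋-difference-set {p} idem c Q colour-difference⇒Q with ∋-colour-class p c | ultra p Q
... | _ | inj₁ p∋Q = p∋Q
... | k , p∋Cₖ | inj₂ p∋∁Q =
  ⊥-elim (∋-inhabited p (inter p (proj₁ (idem Cₖ) p∋Cₖ) p∋∁Q) λ { x (p∋x+Cₖ , ¬Qx) →
          ∋-inhabited p (inter p p∋Cₖ p∋x+Cₖ) λ { y (cy≡k , cx+y≡k) →
          ¬Qx (colour-difference⇒Q x y (trans cy≡k (sym cx+y≡k))) } })
  where
  Cₖ : Subset
  Cₖ x = c x ≡ k

%≡%⇒∣- : ∀ n .{{_ : NonZero n}} i j → i % n ≡ j % n → n ∣ j - i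
%≡%⇒∣- n i j i%n≡j%n = divides (j / n - i / n) (begin
  j - i
    ≡⟨ cong₂ _-_ (a≡a%n+[a/n]*n j n) (a≡a%n+[a/n]*n i n) ⟩
  (+ (j % n) + j / n * n) - (+ (i % n) + i / n * n)
    ≡⟨ cong (λ r → (+ (j % n) + j / n * n) - (+ r + i / n * n)) i%n≡j%n ⟩
  (+ (j % n) + j / n * n) - (+ (j % n) + i / n * n)
    ≡⟨ cancel (+ (j % n)) (j / n) (i / n) n ⟩
  (j / n - i / n) * n ∎)
  where
  open ≡-Reasoning
  cancel : ∀ r s t n → (r + s * n) - (r + t * n) ≡ (s - t) * n
  cancel = solve-∀

idempotent-∋-divisible : ∀ {p} → Idempotent p → (π : Lip → ℤ) → (∀ x y → π (x +L y) ≡ π x + π y) →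
                         ∀ n .{{_ : NonZero n}} → p ∋ (λ x → n ∣ π x)
idempotent-∋-divisible {p} idem π π-additive n =
  idempotent-∋-difference-set {p} idem residue (λ x → n ∣ π x) λ x y same-residue →
    subst (n ∣_) (difference x y) (%≡%⇒∣- n (π y) (π (x +L y)) (fromℕ<-injective _ _ _ _ same-residue))
  where
  residue : Lip → Fin ∣ n ∣
  residue x = fromℕ< (n%d<d (π x) n)
  difference : ∀ x y → π (x +L y) - π y ≡ π x
  difference x y = trans (cong (_- π y) (π-additive x y)) (+-cancel (π x) (π y))
    where
    +-cancel : ∀ u v → (u + v) - v ≡ u
    +-cancel = solve-∀

Multiple : ℤ → Subset
Multiple n x = Σ Lip λ w → x ≡ n • w

idempotent-∋-multiples : ∀ {p} → Idempotent p → ∀ n .{{_ : NonZero n}} → p ∋ Multiple n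
idempotent-∋-multiples {p} idem n =
  upward p (inter p (divisible re λ _ _ → refl) (inter p (divisible iC λ _ _ → refl)
           (inter p (divisible jC λ _ _ → refl) (divisible kC λ _ _ → refl))))
    λ { x (divides w₀ x₀≡ , divides w₁ x₁≡ , divides w₂ x₂≡ , divides w₃ x₃≡) →
        quat w₀ w₁ w₂ w₃ , quat-cong (trans x₀≡ (*-comm w₀ n)) (trans x₁≡ (*-comm w₁ n))
                                     (trans x₂≡ (*-comm w₂ n)) (trans x₃≡ (*-comm w₃ n)) }
  where
  divisible : (π : Lip → ℤ) → (∀ x y → π (x +L y) ≡ π x + π y) → p ∋ (λ x → n ∣ π x)
  divisible π π-additive = idempotent-∋-divisible {p} idem π π-additive n

record IsFiniteIndexEmbedding (f : Lip → Lip) : Set where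
  field
    additive           : ∀ x y → f (x +L y) ≡ f x +L f y
    injective          : ∀ {x y} → f x ≡ f y → x ≡ y
    index              : ℤ
    index-nonZero      : NonZero index
    image-⊇-multiples : ∀ w → Σ Lip λ x → f x ≡ index • w

module FiniteIndexEmbedding {f : Lip → Lip} (embedding : IsFiniteIndexEmbedding f) where
  open IsFiniteIndexEmbedding embedding
  open ≈-Reasoning

  Preimage : (βL → Set₁) → βL → Set₁
  Preimage I s = Σ βL λ r → I r × r ≈ map f s

  Preimage-isIdeal : ∀ {p} → Idempotent p → InK p → ∀ {I} → IsIdeal I → IsIdeal (Preimage I)
  Preimage-isIdeal {p} idem p∈K {I} I-ideal = record
    { nonempty = nonempty
    ; leftAbs  = leftAbs
    ; rightAbs = rightAbs
    }
    where
    nonempty : Σ βL (Preimage I)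
    nonempty with p∈K I I-ideal
    ... | r , Ir , r≈p = s , r , Ir , ≈-sym {map f s} {r} (map-lift injective r r∋Im)
      where
      r∋Im : r ∋ Image f (λ _ → ⊤)
      r∋Im = upward r (proj₂ (r≈p (Multiple index)) (idempotent-∋-multiples {p} idem index {{index-nonZero}}))
               λ { _ (w , z≡) → let x , fx≡ = image-⊇-multiples w in x , tt , trans fx≡ (sym z≡) }
      s : βL
      s = lift injective r r∋Im
    leftAbs : ∀ q s → Preimage I s → Σ βL λ t → Preimage I t × t ≈ q ⊕ s
    leftAbs q s (r , Ir , r≈fs) with IsIdeal.leftAbs I-ideal (map f q) r Ir
    ... | r′ , Ir′ , r′≈ = q +β s , (r′ , Ir′ , (begin
          r′                   ≈⟨ r′≈ ⟩
          map f q +β r         ≈⟨ +β-congʳ (map f q) {r} {map f s} r≈fs ⟩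
          map f q +β map f s   ≈⟨ map-+β {f} additive q s ⟨
          map f (q +β s)       ∎)) , ≈-refl {q +β s}
    rightAbs : ∀ s q → Preimage I s → Σ βL λ t → Preimage I t × t ≈ s ⊕ q
    rightAbs s q (r , Ir , r≈fs) with IsIdeal.rightAbs I-ideal r (map f q) Ir
    ... | r′ , Ir′ , r′≈ = s +β q , (r′ , Ir′ , (begin
          r′                   ≈⟨ r′≈ ⟩
          r +β map f q         ≈⟨ +β-congˡ {r} {map f s} (map f q) r≈fs ⟩
          map f s +β map f q   ≈⟨ map-+β {f} additive s q ⟨
          map f (s +β q)       ∎)) , ≈-refl {s +β q}

  map-InK : ∀ {p} → Idempotent p → InK p → InK (map f p)
  map-InK {p} idem p∈K I I-ideal with p∈K (Preimage I) (Preimage-isIdeal {p} idem p∈K I-ideal)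
  ... | s , (r , Ir , r≈fs) , s≈p = r , Ir , (begin
        r        ≈⟨ r≈fs ⟩
        map f s  ≈⟨ map-cong f {s} {p} s≈p ⟩
        map f p  ∎)

  CentralStar-preimage : ∀ {A} → CentralStar A → CentralStar (λ x → A (f x))
  CentralStar-preimage A* p p∈K idem =
    A* (map f p) (map-InK {p} idem p∈K) (map-idempotent {f} additive {p} idem)

·L-left-embedding : ∀ {a} → ¬ a ≡ 0L → IsFiniteIndexEmbedding (a ·L_)
·L-left-embedding {a} a≢0 = record
  { additive           = ·L-distribˡ-+L a
  ; injective          = scaled-retraction⇒injective (a ·L_) (conj a ·L_) (norm a) {{norm-nonZero a≢0}}
                           (·L-conj-retractionˡ a)
  ; index              = norm a
  ; index-nonZero      = norm-nonZero a≢0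
  ; image-⊇-multiples = λ w → conj a ·L w , ·L-conj-sectionˡ a w
  }

·L-right-embedding : ∀ {b} → ¬ b ≡ 0L → IsFiniteIndexEmbedding (_·L b)
·L-right-embedding {b} b≢0 = record
  { additive           = ·L-distribʳ-+L b
  ; injective          = scaled-retraction⇒injective (_·L b) (_·L conj b) (norm b) {{norm-nonZero b≢0}}
                           (·L-conj-retractionʳ b)
  ; index              = norm b
  ; index-nonZero      = norm-nonZero b≢0
  ; image-⊇-multiples = λ w → w ·L conj b , ·L-conj-sectionʳ b w
  }

lemma3p2 : (A : Subset) (a b : Lip) → ¬ (a ≡ 0L) → ¬ (b ≡ 0L) →
           CentralStar A →
           CentralStar (a ⁻¹· A) × CentralStar (A ·⁻¹ b) × CentralStar (conj⁻¹ a A b)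
lemma3p2 A a b a≢0 b≢0 A* = left-preimage A* , right-preimage A* , left-preimage (right-preimage A*)
  where
  left-preimage : ∀ {B} → CentralStar B → CentralStar (a ⁻¹· B)
  left-preimage = FiniteIndexEmbedding.CentralStar-preimage (·L-left-embedding a≢0)
  right-preimage : ∀ {B} → CentralStar B → CentralStar (B ·⁻¹ b)
  right-preimage = FiniteIndexEmbedding.CentralStar-preimage (·L-right-embedding b≢0)
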